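{- If $P$ is a zero game, then $P$ has an even number of unresolved crossings and $P$ is U2 (the Unknotter can force a win moving second).
   Context: A knot pseudodiagram is a knot projection in which each crossing is resolved or unresolved, taken up to planar isotopy and Reidemeister moves. In the knotting-unknotting game the Knotter and Unknotter alternately resolve one unresolved crossing; when none remain, the Unknotter wins iff the knot is the unknot. An option of $P$ is obtained by resolving one unresolved crossing. $P$ is U1 (resp. U2) if the Unknotter can force a win moving first (resp. second); a fully resolved unknot diagram is U1 and U2, a fully resolved nontrivial knot diagram is neither. A zero game is defined recursively: $P$ is a zero game iff $P$ is U1 and for every option $Q$ of $P$ there exists an option $R$ of $Q$ which is a zero game. -}

module Defs where

open import Data.Nat using (ℕ; zero; suc)
open import Data.Product using (Σ; _×_; ∃)
open import Relation.Binary.PropositionalEquality using (_≡_)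

-- Pos        : knot pseudodiagrams (up to planar isotopy / Reidemeister moves)
-- unresolved : number of unresolved crossings
-- Opt P Q    : Q is obtained from P by resolving one unresolved crossing
-- Unknot P   : the knot represented by P is trivial (only consulted when
--              P is fully resolved)
record PseudodiagramGame : Set₁ where
  field
    Pos        : Set
    unresolved : Pos → ℕ
    Opt        : Pos → Pos → Set
    Unknot     : Pos → Set
    opt-unresolved : ∀ {P Q} → Opt P Q → unresolved P ≡ suc (unresolved Q)
    opt-exists     : ∀ P n → unresolved P ≡ suc n → ∃ λ Q → Opt P Q

module Game (G : PseudodiagramGame) where
  open PseudodiagramGame G

  mutual
    -- U1 P : the Unknotter, moving first, can force a win from P.
    data U1 (P : Pos) : Set where
      u1-done : unresolved P ≡ zero → Unknot P → U1 P
      u1-move : (Q : Pos) → Opt P Q → U2 Q → U1 P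

    -- U2 P : the Unknotter, moving second, can force a win from P.
    data U2 (P : Pos) : Set where
      u2-done : unresolved P ≡ zero → Unknot P → U2 P
      u2-move : (n : ℕ) → unresolved P ≡ suc n →
                ((Q : Pos) → Opt P Q → U1 Q) → U2 P

  -- Zero games (the recursion is well-founded since options have fewer
  -- unresolved crossings, so the inductive reading is the recursive one).
  data ZeroGame (P : Pos) : Set where
    zero-game : U1 P →
                ((Q : Pos) → Opt P Q → Σ Pos (λ R → Opt Q R × ZeroGame R)) →
                ZeroGame P

-- Both claims are proved by structural induction on the derivation of
-- "P is a zero game", whose sub-derivations are the zero games R that
-- answer a move P → Q.  Since every move resolves exactly one crossing,
-- such an answer R has exactly two unresolved crossings fewer than P.
--
--  * Parity: if P has an unresolved crossing, make any move P → Q; its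
--    answer R is a zero game with unresolved P = 2 + unresolved R, so
--    evenness passes from R to P.
--  * U2: if P is fully resolved, the Unknotter's first-move win cannot
--    consist of a move, so P is an unknot and P is U2.  Otherwise, against
--    each Knotter move P → Q the Unknotter plays the zero-game answer
--    Q → R, and R is U2 by induction; hence every Q is U1, i.e. P is U2.
module Submission where

open import Defs
open import Data.Nat using (zero; suc)
open import Data.Nat.Divisibility using (_∣_; _∣0; ∣-refl; ∣m∣n⇒∣m+n)
open import Data.Product using (_×_; _,_; Σ)
open import Data.Empty using (⊥; ⊥-elim)
open import Relation.Binary.PropositionalEquality using (_≡_; refl; sym; trans)

module ZeroGames (G : PseudodiagramGame) where
  open PseudodiagramGame G
  open Game G

  resolved-has-no-option : ∀ {P Q} → unresolved P ≡ zero → Opt P Q → ⊥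
  resolved-has-no-option P-resolved P→Q
    with trans (sym P-resolved) (opt-unresolved P→Q)
  ... | ()

  two-moves : ∀ {P Q R} → Opt P Q → Opt Q R →
              unresolved P ≡ suc (suc (unresolved R))
  two-moves P→Q Q→R rewrite opt-unresolved P→Q | opt-unresolved Q→R = refl

  resolved-U1⇒U2 : ∀ {P} → unresolved P ≡ zero → U1 P → U2 P
  resolved-U1⇒U2 P-resolved (u1-done _ unknot)  = u2-done P-resolved unknot
  resolved-U1⇒U2 P-resolved (u1-move _ P→Q _) = ⊥-elim (resolved-has-no-option P-resolved P→Q)

  zero-game-even : ∀ {P} → ZeroGame P → 2 ∣ unresolved P
  zero-game-even {P} (zero-game _ answer) with unresolved P in P-count
  ... | zero  = 2 ∣0
  ... | suc n with opt-exists P n P-count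
  ...   | Q , P→Q with answer Q P→Q
  ...     | R , Q→R , R-zero
    rewrite sym P-count | two-moves P→Q Q→R =
      ∣m∣n⇒∣m+n (∣-refl {2}) (zero-game-even R-zero)

  zero-game-U2 : ∀ {P} → ZeroGame P → U2 P
  zero-game-U2 {P} (zero-game P-U1 answer) with unresolved P in P-count
  ... | zero  = resolved-U1⇒U2 P-count P-U1
  ... | suc n = u2-move n P-count reply
    where
    reply : (Q : Pos) → Opt P Q → U1 Q
    reply Q P→Q with answer Q P→Q
    ... | R , Q→R , R-zero = u1-move R Q→R (zero-game-U2 R-zero)

lemma3p4 : (G : PseudodiagramGame) → (P : PseudodiagramGame.Pos G) →
    Game.ZeroGame G P →
    (2 ∣ PseudodiagramGame.unresolved G P) × Game.U2 G P
lemma3p4 G P P-zero = zero-game-even P-zero , zero-game-U2 P-zero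
  where open ZeroGames G
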